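{- Let $\mathbf L=(L,\vee,\wedge)$ be a finite chain with least element $0$ and greatest element $1$, and let $a\in L$. Then $|P_{\{a\}}(\mathbf L)|=2|[0,a]|\cdot|[a,1]|-1$.
   Context: For a lattice $\mathbf L$ and $S\subseteq L$, $P_S(\mathbf L):=\{(x,y)\in L^2\mid x\wedge y\leq z\leq x\vee y\text{ for all }z\in S\}$. $[c,d]$ denotes the interval $\{x\in L\mid c\leq x\leq d\}$. -}

module Defs where

open import Level using (Level; _⊔_)
open import Data.Nat using (ℕ)
open import Data.Fin using (Fin)
open import Data.Product using (Σ; _×_; _,_; proj₁; proj₂; ∃)
open import Relation.Binary using (Setoid; Rel; Total)
open import Relation.Binary.PropositionalEquality as ≡ using (_≡_)
open import Relation.Binary.Lattice.Bundles using (BoundedLattice)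
open import Function.Bundles using (Bijection)

private
  variable
    c ℓ₁ ℓ₂ p : Level

SubSetoid : (S : Setoid c ℓ₁) → (Setoid.Carrier S → Set p) → Setoid (c ⊔ p) ℓ₁
SubSetoid S P = record
  { Carrier = Σ (Setoid.Carrier S) P
  ; _≈_ = λ u v → Setoid._≈_ S (proj₁ u) (proj₁ v)
  ; isEquivalence = record
    { refl = Setoid.refl S
    ; sym = Setoid.sym S
    ; trans = Setoid.trans S
    }
  }

Square : Setoid c ℓ₁ → Setoid c ℓ₁
Square S = record
  { Carrier = Setoid.Carrier S × Setoid.Carrier S
  ; _≈_ = λ u v → Setoid._≈_ S (proj₁ u) (proj₁ v) × Setoid._≈_ S (proj₂ u) (proj₂ v)
  ; isEquivalence = record
    { refl = Setoid.refl S , Setoid.refl S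
    ; sym = λ { (e , f) → Setoid.sym S e , Setoid.sym S f }
    ; trans = λ { (e , f) (g , h) → Setoid.trans S e g , Setoid.trans S f h }
    }
  }

HasCard : Setoid c ℓ₁ → ℕ → Set (c ⊔ ℓ₁)
HasCard S n = Bijection (≡.setoid (Fin n)) S

IsFinite : Setoid c ℓ₁ → Set (c ⊔ ℓ₁)
IsFinite S = ∃ λ n → HasCard S n

module _ (L : BoundedLattice c ℓ₁ ℓ₂) where
  open BoundedLattice L

  IsChain : Set (c ⊔ ℓ₂)
  IsChain = Total _≤_

  Interval : Carrier → Carrier → Setoid (c ⊔ ℓ₂) ℓ₁
  Interval x y = SubSetoid setoid (λ z → x ≤ z × z ≤ y)

  P : (Carrier → Set p) → Setoid (c ⊔ ℓ₂ ⊔ p) ℓ₁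
  P S = SubSetoid (setoid' ) (λ xy → ∀ z → S z → (proj₁ xy ∧ proj₂ xy) ≤ z × z ≤ (proj₁ xy ∨ proj₂ xy))
    where setoid' = Square setoid

  ⟦_⟧ : Carrier → Carrier → Set ℓ₁
  ⟦ a ⟧ z = z ≈ a

{-# OPTIONS --safe #-}
-- On a chain, x ∧ y ≤ a ≤ x ∨ y holds exactly when a lies between x and y, so P_{a}
-- consists of the rectangle [0,a] × [a,1] and its mirror image under (x , y) ↦ (y , x).
-- The two copies meet only in (a , a), whence |P_{a}| = m n + (m n − 1).
module Submission where

open import Defs
open import Level using (Level; _⊔_)
open import Data.Nat using (ℕ; suc; _+_; _*_; _∸_)
open import Data.Nat.Properties using (*-assoc; +-suc; +-identityʳ)
open import Data.Fin using (Fin; punchIn; punchOut)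
open import Data.Fin.Properties using (+↔⊎; *↔×; punchInᵢ≢i; punchIn-injective; punchIn-punchOut)
import Data.Fin.Properties as Fin
open import Data.Product using (_×_; _,_; proj₁; proj₂; ∃)
open import Data.Product.Relation.Binary.Pointwise.NonDependent using (_×ₛ_)
import Data.Product.Relation.Binary.Pointwise.NonDependent as ×
open import Data.Product.Function.NonDependent.Setoid using (_×-bijection_)
open import Data.Sum using (_⊎_; inj₁; inj₂)
open import Data.Sum.Relation.Binary.Pointwise using (_⊎ₛ_; inj₁; inj₂)
import Data.Sum.Relation.Binary.Pointwise as ⊎
open import Data.Sum.Function.Setoid using (_⊎-bijection_)
open import Data.Empty using (⊥-elim)
open import Relation.Nullary using (¬_; yes; no)
open import Relation.Nullary.Decidable using (_×-dec_; map′)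
open import Relation.Binary using (Setoid; Decidable)
open import Relation.Binary.PropositionalEquality as ≡ using (_≡_; _≢_)
open import Relation.Binary.Lattice.Bundles using (BoundedLattice)
open import Function.Bundles using (Bijection)
open import Function.Properties.Inverse using (Inverse⇒Bijection)
import Function.Construct.Composition as Compose
import Function.Construct.Symmetry as Symmetry

private
  variable
    c ℓ : Level
    S T : Setoid c ℓ

hasCard-transport : ∀ {n} → HasCard S n → Bijection S T → HasCard T n
hasCard-transport = Compose.bijection

hasCard-× : ∀ {m n} → HasCard S m → HasCard T n → HasCard (S ×ₛ T) (m * n)
hasCard-× cardS cardT =
  Compose.bijection (Inverse⇒Bijection *↔×)
    (Compose.bijection (Inverse⇒Bijection (Symmetry.inverse ×.Pointwise-≡↔≡))
      (cardS ×-bijection cardT))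

hasCard-⊎ : ∀ {m n} → HasCard S m → HasCard T n → HasCard (S ⊎ₛ T) (m + n)
hasCard-⊎ cardS cardT =
  Compose.bijection (Inverse⇒Bijection +↔⊎)
    (Compose.bijection (Inverse⇒Bijection (Symmetry.inverse (⊎.Pointwise-≡↔≡ _ _)))
      (cardS ⊎-bijection cardT))

Punctured : (S : Setoid c ℓ) → Setoid.Carrier S → Setoid (c ⊔ ℓ) ℓ
Punctured S s = SubSetoid S (λ x → ¬ Setoid._≈_ S x s)

module _ {S : Setoid c ℓ} where
  open Setoid S

  finite⇒decidable : IsFinite S → Decidable _≈_
  finite⇒decidable (n , card) x y =
    map′ (λ i≡j → trans (sym (index↦ x ≡.refl)) (index↦ y i≡j))
         (λ x≈y → injective (trans (index↦ x ≡.refl) (trans x≈y (sym (index↦ y ≡.refl)))))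
         (index x Fin.≟ index y)
    where
    open Bijection card using (injective; surjective)
    index : Carrier → Fin n
    index z = proj₁ (surjective z)
    index↦ : ∀ z {k} → k ≡ index z → Bijection.to card k ≈ z
    index↦ z = proj₂ (surjective z)

  hasCard-punctured : ∀ {n} → HasCard S (suc n) → (s : Carrier) → HasCard (Punctured S s) n
  hasCard-punctured {n} card s = record
    { to = to
    ; cong = λ { ≡.refl → refl }
    ; bijective = (λ e → punchIn-injective i₀ _ _ (injective e)) , surjective′
    }
    where
    open Bijection card using (injective; surjective)
    i₀ : Fin (suc n)
    i₀ = proj₁ (surjective s)
    i₀↦s : Bijection.to card i₀ ≈ s
    i₀↦s = proj₂ (surjective s) ≡.refl
    to : Fin n → Setoid.Carrier (Punctured S s)
    to j = Bijection.to card (punchIn i₀ j)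
         , λ e → punchInᵢ≢i i₀ j (injective (trans e (sym i₀↦s)))
    surjective′ : ∀ x → ∃ λ j → ∀ {k} → k ≡ j → Setoid._≈_ (Punctured S s) (to k) x
    surjective′ (x , x≉s) = punchOut i₀≢i , λ { ≡.refl → i↦x (punchIn-punchOut i₀≢i) }
      where
      i : Fin (suc n)
      i = proj₁ (surjective x)
      i↦x : ∀ {k} → k ≡ i → Bijection.to card k ≈ x
      i↦x = proj₂ (surjective x)
      i₀≢i : i₀ ≢ i
      i₀≢i e = x≉s (trans (sym (i↦x e)) i₀↦s)

suc-n+n≡2*suc-n∸1 : ∀ n → suc n + n ≡ 2 * suc n ∸ 1
suc-n+n≡2*suc-n∸1 n = begin
  suc (n + n)       ≡⟨ ≡.sym (+-suc n n) ⟩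
  n + suc n         ≡⟨ ≡.cong (λ k → n + suc k) (≡.sym (+-identityʳ n)) ⟩
  n + suc (n + 0)   ∎
  where open ≡.≡-Reasoning

module _ {c ℓ₁ ℓ₂} (L : BoundedLattice c ℓ₁ ℓ₂) where
  open BoundedLattice L

  ⟦⟧-member : ∀ {a x y} → x ∧ y ≤ a → a ≤ x ∨ y → ∀ z → z ≈ a → x ∧ y ≤ z × z ≤ x ∨ y
  ⟦⟧-member x∧y≤a a≤x∨y z z≈a = trans x∧y≤a (reflexive (Eq.sym z≈a)) , trans (reflexive z≈a) a≤x∨y

  chain-between : IsChain L → ∀ {a x y} → x ∧ y ≤ a → a ≤ x ∨ y → (x ≤ a × a ≤ y) ⊎ (y ≤ a × a ≤ x)
  chain-between total {x = x} {y} x∧y≤a a≤x∨y with total x y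
  ... | inj₁ x≤y = inj₁ (trans (∧-greatest refl x≤y) x∧y≤a , trans a≤x∨y (∨-least x≤y refl))
  ... | inj₂ y≤x = inj₂ (trans (∧-greatest y≤x refl) x∧y≤a , trans a≤x∨y (∨-least refl y≤x))

  module _ (a : Carrier) where

    Rectangle : Setoid (c ⊔ ℓ₂) ℓ₁
    Rectangle = Interval L ⊥ a ×ₛ Interval L a ⊤

    corner : Setoid.Carrier Rectangle
    corner = (a , minimum a , refl) , (a , refl , maximum a)

    P-⟦⟧-decomposition : IsChain L → Decidable _≈_ →
      Bijection (Rectangle ⊎ₛ Punctured Rectangle corner) (P L (⟦_⟧ L a))
    P-⟦⟧-decomposition total _≟_ = record
      { to = to
      ; cong = cong
      ; bijective = injective , surjective
      }
      where
      open Setoid (Rectangle ⊎ₛ Punctured Rectangle corner) using () renaming (Carrier to D; _≈_ to _≈ᴰ_)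
      open Setoid (P L (⟦_⟧ L a)) using () renaming (Carrier to Pₐ; _≈_ to _≈ᴾ_)

      to : D → Pₐ
      to (inj₁ ((x , _ , x≤a) , (y , a≤y , _))) =
        (x , y) , ⟦⟧-member (trans (x∧y≤x x y) x≤a) (trans a≤y (y≤x∨y x y))
      to (inj₂ (((x , _ , x≤a) , (y , a≤y , _)) , _)) =
        (y , x) , ⟦⟧-member (trans (x∧y≤y y x) x≤a) (trans a≤y (x≤x∨y y x))

      cong : ∀ {r s} → r ≈ᴰ s → to r ≈ᴾ to s
      cong (inj₁ (x≈x′ , y≈y′)) = x≈x′ , y≈y′
      cong (inj₂ (x≈x′ , y≈y′)) = y≈y′ , x≈x′

      disjoint : ∀ r t → ¬ to (inj₁ r) ≈ᴾ to (inj₂ t)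
      disjoint ((x , _ , x≤a) , (y , a≤y , _)) (((x′ , _ , x′≤a) , (y′ , a≤y′ , _)) , t≉corner) (x≈y′ , y≈x′) =
        t≉corner ( antisym x′≤a (trans a≤y (reflexive y≈x′))
                 , antisym (trans (reflexive (Eq.sym x≈y′)) x≤a) a≤y′ )

      injective : ∀ {r s} → to r ≈ᴾ to s → r ≈ᴰ s
      injective {inj₁ _} {inj₁ _} (x≈x′ , y≈y′) = inj₁ (x≈x′ , y≈y′)
      injective {inj₂ _} {inj₂ _} (y≈y′ , x≈x′) = inj₂ (x≈x′ , y≈y′)
      injective {inj₁ r} {inj₂ t} e = ⊥-elim (disjoint r t e)
      injective {inj₂ t} {inj₁ r} (e₁ , e₂) = ⊥-elim (disjoint r t (Eq.sym e₁ , Eq.sym e₂))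

      surjective : ∀ p → ∃ λ r → ∀ {s} → s ≈ᴰ r → to s ≈ᴾ p
      surjective ((x , y) , member) with chain-between total (proj₁ (member a Eq.refl)) (proj₂ (member a Eq.refl))
      ... | inj₁ (x≤a , a≤y) = inj₁ ((x , minimum x , x≤a) , (y , a≤y , maximum y)) , cong
      ... | inj₂ (y≤a , a≤x) with (y ≟ a) ×-dec (x ≟ a)
      ...   | yes (y≈a , x≈a) =
                inj₁ ((x , minimum x , reflexive x≈a) , (y , reflexive (Eq.sym y≈a) , maximum y)) , cong
      ...   | no not-corner = inj₂ (((y , minimum y , y≤a) , (x , a≤x , maximum x)) , not-corner) , cong

    P-⟦⟧-card : IsChain L → Decidable _≈_ →
      ∀ {N} → HasCard Rectangle N → HasCard (P L (⟦_⟧ L a)) (2 * N ∸ 1)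
    P-⟦⟧-card total _≟_ {suc n} rectangle =
      ≡.subst (HasCard (P L (⟦_⟧ L a))) (suc-n+n≡2*suc-n∸1 n)
        (hasCard-transport (hasCard-⊎ rectangle (hasCard-punctured rectangle corner))
                           (P-⟦⟧-decomposition total _≟_))
    P-⟦⟧-card total _≟_ {0} empty with () ← proj₁ (Bijection.surjective empty corner)

lemma19 : ∀ {c ℓ₁ ℓ₂ : Level} (L : BoundedLattice c ℓ₁ ℓ₂) →
    IsFinite (BoundedLattice.setoid L) → IsChain L →
    (a : BoundedLattice.Carrier L) (m n : ℕ) →
    HasCard (Interval L (BoundedLattice.⊥ L) a) m →
    HasCard (Interval L a (BoundedLattice.⊤ L)) n →
    HasCard (P L (⟦_⟧ L a)) (2 * m * n ∸ 1)
lemma19 L finite total a m n card[0,a] card[a,1] =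
  ≡.subst (HasCard (P L (⟦_⟧ L a))) (≡.cong (_∸ 1) (≡.sym (*-assoc 2 m n)))
    (P-⟦⟧-card L a total (finite⇒decidable finite) (hasCard-× card[0,a] card[a,1]))
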